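{- For every integer $n\ge 0$ and every $p\in\mathbb{Z}$, $$\beta_{n,\lambda}^{(p)}(x)=\sum_{k=0}^{n}\frac{\lambda^{k}(1)_{k+1,1/\lambda}}{(k+1)^{p}}\sum_{j=0}^{n}\binom{n}{j}(-1)^{j}S_{2,\lambda}(j,k)\,(x)_{n-j,-\lambda}.$$
   Context: Let $\lambda$ be a nonzero real number. For $\mu\in\mathbb{R}$, $(x)_{0,\mu}=1$, $(x)_{n,\mu}=x(x-\mu)\cdots(x-(n-1)\mu)$ for $n\ge1$, and $e_\mu^x(t)=\sum_{k\ge0}(x)_{k,\mu}t^k/k!$ (formal power series in $t$), $e_\mu(t)=e_\mu^1(t)$. The degenerate Stirling numbers of the second kind are defined by $(x)_{n,\lambda}=\sum_{k=0}^n S_{2,\lambda}(n,k)(x)_k$ where $(x)_k=x(x-1)\cdots(x-k+1)$, with $S_{2,\lambda}(n,k)=0$ for $k>n$. For $k\in\mathbb{Z}$, the degenerate polylogarithm is $\mathrm{Li}_{k,\lambda}(y)=\sum_{n\ge1}\frac{(-\lambda)^{n-1}(1)_{n,1/\lambda}}{(n-1)!\,n^k}y^n$. The degenerate poly-Bernoulli polynomials of index $k$ are defined by $\frac{\mathrm{Li}_{k,\lambda}(1-e_\lambda(-t))}{1-e_\lambda(-t)}e_\lambda^{ -x}(-t)=\sum_{n\ge0}\beta^{(k)}_{n,\lambda}(x)\frac{t^n}{n!}$. -}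

module Defs where

open import Level using (Level; _⊔_) renaming (suc to lsuc)
open import Data.Nat as ℕ using (ℕ; zero; suc; _∸_)
open import Data.Nat.Combinatorics using (_C_)
open import Data.Integer as ℤ using (ℤ; +_; -[1+_])
open import Relation.Nullary using (¬_)
open import Data.Product using () renaming (_×_ to _×'_)
open import Algebra.Bundles using (CommutativeRing)

ringFromℕ : ∀ {c ℓ} (R : CommutativeRing c ℓ) → ℕ → CommutativeRing.Carrier R
ringFromℕ R zero    = CommutativeRing.0# R
ringFromℕ R (suc n) = CommutativeRing._+_ R (CommutativeRing.1# R) (ringFromℕ R n)

-- A field of characteristic zero (ℝ is an instance).  The inverse is total
-- (value at 0 unconstrained); it is only ever applied to nonzero elements.
record CharZeroField (c ℓ : Level) : Set (lsuc (c ⊔ ℓ)) where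
  field
    commRing : CommutativeRing c ℓ
  open CommutativeRing commRing public hiding (ring)
  field
    _⁻¹      : Carrier → Carrier
    ⁻¹-cong  : ∀ {x y} → x ≈ y → x ⁻¹ ≈ y ⁻¹
    ⁻¹-inv   : ∀ x → ¬ (x ≈ 0#) → x * (x ⁻¹) ≈ 1#
    charZero : ∀ n → ¬ (ringFromℕ commRing (suc n) ≈ 0#)

module FieldDefs {c ℓ : Level} (F : CharZeroField c ℓ) where
  open CharZeroField F public

  fromℕ : ℕ → Carrier
  fromℕ = ringFromℕ commRing

  infixr 8 _^_
  _^_ : Carrier → ℕ → Carrier
  x ^ zero  = 1#
  x ^ suc n = x * (x ^ n)

  invPow : Carrier → ℤ → Carrier
  invPow a (+ m)      = (a ^ m) ⁻¹
  invPow a -[1+ m ]   = a ^ suc m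

  sumTo : ℕ → (ℕ → Carrier) → Carrier
  sumTo zero    f = f 0
  sumTo (suc n) f = sumTo n f + f (suc n)

  dfall : Carrier → Carrier → ℕ → Carrier
  dfall μ x zero    = 1#
  dfall μ x (suc n) = dfall μ x n * (x - fromℕ n * μ)

  fall : Carrier → ℕ → Carrier
  fall x k = dfall 1# x k

  fact : ℕ → Carrier
  fact zero    = 1#
  fact (suc n) = fromℕ (suc n) * fact n

  Series : Set c
  Series = ℕ → Carrier

  oneS : Series
  oneS zero    = 1#
  oneS (suc _) = 0#

  _-ₛ_ : Series → Series → Series
  (f -ₛ g) n = f n - g n

  _·ₛ_ : Series → Series → Series
  (f ·ₛ g) n = sumTo n (λ i → f i * g (n ∸ i))

  powS : Series → ℕ → Series
  powS g zero    = oneS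
  powS g (suc m) = g ·ₛ powS g m

  negArg : Series → Series
  negArg f n = (- 1#) ^ n * f n

  -- composition f(g(t)) for g with zero constant term
  -- (coefficient of t^n only receives contributions from g^m with m ≤ n)
  compS : Series → Series → Series
  compS f g n = sumTo n (λ m → f m * powS g m n)

  eS : Carrier → Carrier → Series
  eS μ x k = dfall μ x k * (fact k ⁻¹)

  -- Li_{k,λ}(y) / y  as a power series in y:
  -- coefficient of y^m is (-λ)^m (1)_{m+1,1/λ} / (m! (m+1)^k)
  LiOverY : ℤ → Carrier → Series
  LiOverY k lam m =
    ((- lam) ^ m) * dfall (lam ⁻¹) 1# (suc m) * (fact m ⁻¹) * invPow (fromℕ (suc m)) k

  -- generating function of the degenerate poly-Bernoulli polynomials:
  -- Li_{k,λ}(1 - e_λ(-t)) / (1 - e_λ(-t)) · e_λ^{-x}(-t)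
  betaGF : ℤ → Carrier → Carrier → Series
  betaGF k lam x =
    compS (LiOverY k lam) (oneS -ₛ negArg (eS lam 1#)) ·ₛ negArg (eS lam (- x))

  beta : ℤ → Carrier → ℕ → Carrier → Carrier
  beta k lam n x = fact n * betaGF k lam x n

  IsDegStirling2 : Carrier → (ℕ → ℕ → Carrier) → Set (c ⊔ ℓ)
  IsDegStirling2 lam S =
    (∀ n k → n ℕ.< k → S n k ≈ 0#) ×'
    (∀ n x → dfall lam x n ≈ sumTo n (λ k → S n k * fall x k))

-- Expanding (1 + x)_{n,λ} in the falling-factorial basis in two ways (degenerate
-- Vandermonde, or (1 + x)_k = (x)_k + k (x)_{k-1}) and comparing coefficients, which are
-- unique in characteristic zero, gives the recurrence
--   Σ_i C(n,i) (1)_{i,λ} S_{2,λ}(n-i,k) = S_{2,λ}(n,k) + (k+1) S_{2,λ}(n,k+1).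
-- It is exactly what an induction on m needs to show that the coefficient of tⁿ in
-- (1 - e_λ(-t))^m is (-1)^(m+n) m! S_{2,λ}(n,m) / n!. Substituting this into
-- Li_{p,λ}(y)/y at y = 1 - e_λ(-t), multiplying by e_λ^{-x}(-t) = Σ_l (x)_{l,-λ} t^l / l!
-- and exchanging the two sums gives the formula.

module Submission where

open import Defs
open import Level using (Level)
open import Data.Nat as ℕ using (ℕ; zero; suc; _∸_; _≤_; _<_; z≤n; s≤s)
import Data.Nat.Properties as ℕ
open import Data.Nat.Properties using (_!*_!≢0)
open import Data.Nat.Combinatorics using (_C_; nCk≡n!/k![n-k]!; k![n∸k]!∣n!; nCk+nC[k+1]≡[n+1]C[k+1]; k>n⇒nCk≡0)
open import Data.Nat.DivMod using (m/n*n≡m)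
open import Data.Nat.Induction using (<-rec)
open import Data.Integer as ℤ using (ℤ; +_; -[1+_])
import Data.Integer.Properties as ℤ
open import Data.Sign as Sign using (Sign)
open import Data.Sum using (inj₁; inj₂)
open import Data.Product using (proj₁; proj₂)
open import Data.Maybe using (Maybe; just; nothing)
open import Data.Empty using (⊥-elim)
open import Relation.Nullary using (¬_; yes; no)
open import Relation.Binary.Definitions using (tri<; tri≈; tri>)
open import Relation.Binary.PropositionalEquality as ≡ using (_≡_; _≢_)
open import Algebra.Bundles using (CommutativeRing; RawRing)

module IntegerEmbedding {c ℓ : Level} (R : CommutativeRing c ℓ) where
  open CommutativeRing R
  open import Relation.Binary.Reasoning.Setoid setoid
  open import Algebra.Properties.Ring ring using (-1*x≈-x; -‿involutive; -0#≈0#; -‿+-comm)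
  open import Algebra.Properties.CommutativeSemigroup *-commutativeSemigroup using (interchange)
  open import Algebra.Properties.AbelianGroup +-abelianGroup using (⁻¹-anti-homo‿-)
  open import Algebra.Properties.Semiring.Mult.TCOptimised semiring using (_×_; 1+×; ×-homo-+; ×1-homo-*)
  import Algebra.Solver.Ring.AlmostCommutativeRing as ACR

  fromℕ : ℕ → Carrier
  fromℕ = ringFromℕ R

  fromℕ≈×1 : ∀ n → fromℕ n ≈ n × 1#
  fromℕ≈×1 zero    = refl
  fromℕ≈×1 (suc n) = trans (+-congˡ (fromℕ≈×1 n)) (sym (1+× n 1#))

  fromℕ-+ : ∀ m n → fromℕ (m ℕ.+ n) ≈ fromℕ m + fromℕ n
  fromℕ-+ m n = begin
    fromℕ (m ℕ.+ n)     ≈⟨ fromℕ≈×1 (m ℕ.+ n) ⟩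
    (m ℕ.+ n) × 1#      ≈⟨ ×-homo-+ 1# m n ⟩
    m × 1# + n × 1#     ≈⟨ +-cong (fromℕ≈×1 m) (fromℕ≈×1 n) ⟨
    fromℕ m + fromℕ n   ∎

  fromℕ-* : ∀ m n → fromℕ (m ℕ.* n) ≈ fromℕ m * fromℕ n
  fromℕ-* m n = begin
    fromℕ (m ℕ.* n)     ≈⟨ fromℕ≈×1 (m ℕ.* n) ⟩
    (m ℕ.* n) × 1#      ≈⟨ ×1-homo-* m n ⟩
    m × 1# * n × 1#     ≈⟨ *-cong (fromℕ≈×1 m) (fromℕ≈×1 n) ⟨
    fromℕ m * fromℕ n   ∎

  ×1-homo-∸ : ∀ {m n} → n ≤ m → (m ∸ n) × 1# ≈ m × 1# - n × 1#
  ×1-homo-∸ {m} {n} n≤m = begin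
    (m ∸ n) × 1#                          ≈⟨ +-identityʳ _ ⟨
    (m ∸ n) × 1# + 0#                     ≈⟨ +-congˡ (-‿inverseʳ (n × 1#)) ⟨
    (m ∸ n) × 1# + (n × 1# - n × 1#)      ≈⟨ +-assoc _ _ _ ⟨
    (m ∸ n) × 1# + n × 1# - n × 1#        ≈⟨ +-congʳ (×-homo-+ 1# (m ∸ n) n) ⟨
    (m ∸ n ℕ.+ n) × 1# - n × 1#           ≡⟨ ≡.cong (λ k → k × 1# - n × 1#) (ℕ.m∸n+n≡m n≤m) ⟩
    m × 1# - n × 1#                       ∎

  -- The optimised multiple n × 1# (rather than ringFromℕ) makes fromℤ (+ 1) and
  -- fromℤ -[1+ 0 ] reduce to 1# and - 1#, so that solver constants match goals.
  fromℤ : ℤ → Carrier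
  fromℤ (+ n)      = n × 1#
  fromℤ -[1+ n ]   = - (suc n × 1#)

  fromℤ-neg : ∀ i → fromℤ (ℤ.- i) ≈ - fromℤ i
  fromℤ-neg (+ zero)  = sym -0#≈0#
  fromℤ-neg (+ suc n) = refl
  fromℤ-neg -[1+ n ]  = sym (-‿involutive _)

  fromℤ-⊖ : ∀ m n → fromℤ (m ℤ.⊖ n) ≈ m × 1# - n × 1#
  fromℤ-⊖ m n with ℕ.≤-total n m
  ... | inj₁ n≤m = trans (reflexive (≡.cong fromℤ (ℤ.⊖-≥ n≤m))) (×1-homo-∸ n≤m)
  ... | inj₂ m≤n = begin
    fromℤ (m ℤ.⊖ n)             ≡⟨ ≡.cong fromℤ (ℤ.⊖-≤ m≤n) ⟩
    fromℤ (ℤ.- (+ (n ∸ m)))     ≈⟨ fromℤ-neg (+ (n ∸ m)) ⟩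
    - ((n ∸ m) × 1#)            ≈⟨ -‿cong (×1-homo-∸ m≤n) ⟩
    - (n × 1# - m × 1#)         ≈⟨ ⁻¹-anti-homo‿- (n × 1#) (m × 1#) ⟩
    m × 1# - n × 1#             ∎

  fromℤ-+ : ∀ i j → fromℤ (i ℤ.+ j) ≈ fromℤ i + fromℤ j
  fromℤ-+ (+ m)    (+ n)    = ×-homo-+ 1# m n
  fromℤ-+ (+ m)    -[1+ n ] = fromℤ-⊖ m (suc n)
  fromℤ-+ -[1+ m ] (+ n)    = trans (fromℤ-⊖ n (suc m)) (+-comm _ _)
  fromℤ-+ -[1+ m ] -[1+ n ] = begin
    - (suc (suc (m ℕ.+ n)) × 1#)           ≡⟨ ≡.cong (λ k → - (suc k × 1#)) (ℕ.+-suc m n) ⟨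
    - ((suc m ℕ.+ suc n) × 1#)             ≈⟨ -‿cong (×-homo-+ 1# (suc m) (suc n)) ⟩
    - (suc m × 1# + suc n × 1#)            ≈⟨ -‿+-comm _ _ ⟨
    - (suc m × 1#) + - (suc n × 1#)        ∎

  fromSign : Sign → Carrier
  fromSign Sign.+ = 1#
  fromSign Sign.- = - 1#

  fromSign-* : ∀ s t → fromSign (s Sign.* t) ≈ fromSign s * fromSign t
  fromSign-* Sign.+ _      = sym (*-identityˡ _)
  fromSign-* Sign.- Sign.+ = sym (*-identityʳ _)
  fromSign-* Sign.- Sign.- = trans (sym (-‿involutive 1#)) (sym (-1*x≈-x (- 1#)))

  fromℤ-◃ : ∀ s n → fromℤ (s ℤ.◃ n) ≈ fromSign s * (n × 1#)
  fromℤ-◃ s       zero    = sym (zeroʳ _)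
  fromℤ-◃ Sign.+ (suc n) = sym (*-identityˡ _)
  fromℤ-◃ Sign.- (suc n) = sym (-1*x≈-x _)

  fromℤ≈sign*∣∣ : ∀ i → fromℤ i ≈ fromSign (ℤ.sign i) * (ℤ.∣ i ∣ × 1#)
  fromℤ≈sign*∣∣ i = trans (reflexive (≡.cong fromℤ (≡.sym (ℤ.◃-inverse i)))) (fromℤ-◃ (ℤ.sign i) ℤ.∣ i ∣)

  fromℤ-* : ∀ i j → fromℤ (i ℤ.* j) ≈ fromℤ i * fromℤ j
  fromℤ-* i j = begin
    fromℤ (i ℤ.* j)
      ≈⟨ fromℤ-◃ (ℤ.sign i Sign.* ℤ.sign j) (ℤ.∣ i ∣ ℕ.* ℤ.∣ j ∣) ⟩
    fromSign (ℤ.sign i Sign.* ℤ.sign j) * ((ℤ.∣ i ∣ ℕ.* ℤ.∣ j ∣) × 1#)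
      ≈⟨ *-cong (fromSign-* (ℤ.sign i) (ℤ.sign j)) (×1-homo-* ℤ.∣ i ∣ ℤ.∣ j ∣) ⟩
    (fromSign (ℤ.sign i) * fromSign (ℤ.sign j)) * (ℤ.∣ i ∣ × 1# * ℤ.∣ j ∣ × 1#)
      ≈⟨ interchange _ _ _ _ ⟩
    (fromSign (ℤ.sign i) * ℤ.∣ i ∣ × 1#) * (fromSign (ℤ.sign j) * ℤ.∣ j ∣ × 1#)
      ≈⟨ *-cong (fromℤ≈sign*∣∣ i) (fromℤ≈sign*∣∣ j) ⟨
    fromℤ i * fromℤ j
      ∎

  ℤ-rawRing : RawRing _ _
  ℤ-rawRing = record
    { Carrier = ℤ ; _≈_ = _≡_ ; _+_ = ℤ._+_ ; _*_ = ℤ._*_ ; -_ = ℤ.-_ ; 0# = + 0 ; 1# = + 1 }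

  fromℤ-homomorphism : ℤ-rawRing ACR.-Raw-AlmostCommutative⟶ ACR.fromCommutativeRing R
  fromℤ-homomorphism = record
    { ⟦_⟧ = fromℤ ; +-homo = fromℤ-+ ; *-homo = fromℤ-* ; -‿homo = fromℤ-neg
    ; 0-homo = refl ; 1-homo = refl }

  fromℤ-≟ : ∀ i j → Maybe (fromℤ i ≈ fromℤ j)
  fromℤ-≟ i j with i ℤ.≟ j
  ... | yes i≡j = just (reflexive (≡.cong fromℤ i≡j))
  ... | no _    = nothing

  open import Algebra.Solver.Ring ℤ-rawRing (ACR.fromCommutativeRing R) fromℤ-homomorphism fromℤ-≟ public
    using (solve; _:=_; con; _:+_; _:*_; _:-_; :-_)

module Development {c ℓ : Level} (F : CharZeroField c ℓ) where
  open FieldDefs F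
  open import Relation.Binary.Reasoning.Setoid setoid
  open import Algebra.Properties.Group +-group using (x∙y⁻¹≈ε⇒x≈y)
  open import Algebra.Properties.CommutativeSemigroup *-commutativeSemigroup using (x∙yz≈y∙xz)
  open IntegerEmbedding commRing using (fromℕ-+; fromℕ-*; solve; _:=_; con; _:+_; _:*_; _:-_; :-_)

  sgn : ℕ → Carrier
  sgn k = (- 1#) ^ k

  ^-distribˡ-+-* : ∀ a m n → a ^ (m ℕ.+ n) ≈ a ^ m * a ^ n
  ^-distribˡ-+-* a zero    n = sym (*-identityˡ _)
  ^-distribˡ-+-* a (suc m) n = trans (*-congˡ (^-distribˡ-+-* a m n)) (sym (*-assoc _ _ _))

  sgn*sgn≈1 : ∀ m → sgn m * sgn m ≈ 1#
  sgn*sgn≈1 zero    = *-identityˡ _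
  sgn*sgn≈1 (suc m) = trans
    (solve 1 (λ s → ((:- con (+ 1)) :* s) :* ((:- con (+ 1)) :* s) := s :* s) refl (sgn m))
    (sgn*sgn≈1 m)

  -^≈sgn*^ : ∀ a m → (- a) ^ m ≈ sgn m * a ^ m
  -^≈sgn*^ a zero    = sym (*-identityˡ _)
  -^≈sgn*^ a (suc m) = begin
    (- a) * (- a) ^ m          ≈⟨ *-congˡ (-^≈sgn*^ a m) ⟩
    (- a) * (sgn m * a ^ m)
      ≈⟨ solve 3 (λ a s p → (:- a) :* (s :* p) := ((:- con (+ 1)) :* s) :* (a :* p)) refl a (sgn m) (a ^ m) ⟩
    sgn (suc m) * a ^ suc m    ∎

  sgn*sgn-∸ : ∀ {i n} → i ≤ n → sgn i * sgn (n ∸ i) ≈ sgn n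
  sgn*sgn-∸ {i} {n} i≤n = begin
    sgn i * sgn (n ∸ i)     ≈⟨ ^-distribˡ-+-* (- 1#) i (n ∸ i) ⟨
    sgn (i ℕ.+ (n ∸ i))     ≡⟨ ≡.cong sgn (ℕ.m+[n∸m]≡n i≤n) ⟩
    sgn n                   ∎

  1≉0 : ¬ (1# ≈ 0#)
  1≉0 1≈0 = charZero 0 (trans (+-identityʳ 1#) 1≈0)

  b*a≈0⇒b≈0 : ∀ {a b} → ¬ (a ≈ 0#) → b * a ≈ 0# → b ≈ 0#
  b*a≈0⇒b≈0 {a} {b} a≉0 ba≈0 = begin
    b                ≈⟨ *-identityʳ b ⟨
    b * 1#           ≈⟨ *-congˡ (⁻¹-inv a a≉0) ⟨
    b * (a * a ⁻¹)   ≈⟨ *-assoc _ _ _ ⟨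
    (b * a) * a ⁻¹   ≈⟨ *-congʳ ba≈0 ⟩
    0# * a ⁻¹        ≈⟨ zeroˡ _ ⟩
    0#               ∎

  fact≉0 : ∀ n → ¬ (fact n ≈ 0#)
  fact≉0 zero    = 1≉0
  fact≉0 (suc n) n+1*n!≈0 = fact≉0 n (b*a≈0⇒b≈0 (charZero n) (trans (*-comm _ _) n+1*n!≈0))

  fact*fact⁻¹≈1 : ∀ n → fact n * fact n ⁻¹ ≈ 1#
  fact*fact⁻¹≈1 n = ⁻¹-inv (fact n) (fact≉0 n)

  fact≈fromℕ-! : ∀ n → fact n ≈ fromℕ (n ℕ.!)
  fact≈fromℕ-! zero    = sym (+-identityʳ _)
  fact≈fromℕ-! (suc n) = trans (*-congˡ (fact≈fromℕ-! n)) (sym (fromℕ-* (suc n) (n ℕ.!)))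

  fact≈C*fact*fact : ∀ {k n} → k ≤ n → fact n ≈ fromℕ (n C k) * fact k * fact (n ∸ k)
  fact≈C*fact*fact {k} {n} k≤n = begin
    fact n                                                  ≈⟨ fact≈fromℕ-! n ⟩
    fromℕ (n ℕ.!)                                           ≡⟨ ≡.cong fromℕ nCk*k!*[n∸k]!≡n! ⟨
    fromℕ ((n C k) ℕ.* (k ℕ.! ℕ.* (n ∸ k) ℕ.!))             ≈⟨ fromℕ-* (n C k) _ ⟩
    fromℕ (n C k) * fromℕ (k ℕ.! ℕ.* (n ∸ k) ℕ.!)           ≈⟨ *-congˡ (fromℕ-* (k ℕ.!) ((n ∸ k) ℕ.!)) ⟩
    fromℕ (n C k) * (fromℕ (k ℕ.!) * fromℕ ((n ∸ k) ℕ.!))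
      ≈⟨ *-congˡ (*-cong (fact≈fromℕ-! k) (fact≈fromℕ-! (n ∸ k))) ⟨
    fromℕ (n C k) * (fact k * fact (n ∸ k))                 ≈⟨ *-assoc _ _ _ ⟨
    fromℕ (n C k) * fact k * fact (n ∸ k)                   ∎
    where
    nCk*k!*[n∸k]!≡n! : (n C k) ℕ.* (k ℕ.! ℕ.* (n ∸ k) ℕ.!) ≡ n ℕ.!
    nCk*k!*[n∸k]!≡n! = ≡.trans (≡.cong (ℕ._* (k ℕ.! ℕ.* (n ∸ k) ℕ.!)) (nCk≡n!/k![n-k]! k≤n))
      (m/n*n≡m {{k ℕ.!* (n ∸ k) !≢0}} (k![n∸k]!∣n! k≤n))

  sumTo-cong : ∀ n {f g : ℕ → Carrier} → (∀ i → i ≤ n → f i ≈ g i) → sumTo n f ≈ sumTo n g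
  sumTo-cong zero    f≈g = f≈g 0 z≤n
  sumTo-cong (suc n) f≈g = +-cong (sumTo-cong n (λ i i≤n → f≈g i (ℕ.m≤n⇒m≤1+n i≤n))) (f≈g (suc n) ℕ.≤-refl)

  sumTo-zero : ∀ n {f : ℕ → Carrier} → (∀ i → i ≤ n → f i ≈ 0#) → sumTo n f ≈ 0#
  sumTo-zero zero    f≈0 = f≈0 0 z≤n
  sumTo-zero (suc n) f≈0 = trans
    (+-cong (sumTo-zero n (λ i i≤n → f≈0 i (ℕ.m≤n⇒m≤1+n i≤n))) (f≈0 (suc n) ℕ.≤-refl))
    (+-identityʳ 0#)

  sumTo-+ : ∀ n (f g : ℕ → Carrier) → sumTo n (λ i → f i + g i) ≈ sumTo n f + sumTo n g
  sumTo-+ zero    f g = refl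
  sumTo-+ (suc n) f g = trans (+-congʳ (sumTo-+ n f g))
    (solve 4 (λ a b x y → (a :+ b) :+ (x :+ y) := (a :+ x) :+ (b :+ y)) refl _ _ _ _)

  sumTo-minus : ∀ n (f g : ℕ → Carrier) → sumTo n (λ i → f i - g i) ≈ sumTo n f - sumTo n g
  sumTo-minus zero    f g = refl
  sumTo-minus (suc n) f g = trans (+-congʳ (sumTo-minus n f g))
    (solve 4 (λ a b x y → (a :- b) :+ (x :- y) := (a :+ x) :- (b :+ y)) refl _ _ _ _)

  sumTo-distribˡ : ∀ n a (f : ℕ → Carrier) → a * sumTo n f ≈ sumTo n (λ i → a * f i)
  sumTo-distribˡ zero    a f = refl
  sumTo-distribˡ (suc n) a f = trans (distribˡ _ _ _) (+-congʳ (sumTo-distribˡ n a f))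

  sumTo-distribʳ : ∀ n a (f : ℕ → Carrier) → sumTo n f * a ≈ sumTo n (λ i → f i * a)
  sumTo-distribʳ zero    a f = refl
  sumTo-distribʳ (suc n) a f = trans (distribʳ _ _ _) (+-congʳ (sumTo-distribʳ n a f))

  sumTo-suc : ∀ n (f : ℕ → Carrier) → sumTo (suc n) f ≈ f 0 + sumTo n (λ i → f (suc i))
  sumTo-suc zero    f = refl
  sumTo-suc (suc n) f = trans (+-congʳ (sumTo-suc n f)) (+-assoc _ _ _)

  sumTo-extend : ∀ {m} n {f : ℕ → Carrier} → m ≤ n → (∀ i → m < i → i ≤ n → f i ≈ 0#) →
                 sumTo m f ≈ sumTo n f
  sumTo-extend zero    z≤n _ = refl
  sumTo-extend {m} (suc n) {f} m≤1+n f≈0 with ℕ.m≤n⇒m<n∨m≡n m≤1+n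
  ... | inj₂ ≡.refl      = refl
  ... | inj₁ (s≤s m≤n) = begin
    sumTo m f            ≈⟨ sumTo-extend n m≤n (λ i m<i i≤n → f≈0 i m<i (ℕ.m≤n⇒m≤1+n i≤n)) ⟩
    sumTo n f            ≈⟨ +-identityʳ _ ⟨
    sumTo n f + 0#       ≈⟨ +-congˡ (f≈0 (suc n) (s≤s m≤n) ℕ.≤-refl) ⟨
    sumTo (suc n) f      ∎

  sumTo-single : ∀ n k {f : ℕ → Carrier} → k ≤ n → (∀ i → i ≤ n → i ≢ k → f i ≈ 0#) → sumTo n f ≈ f k
  sumTo-single n zero    {f} k≤n f≈0 = begin
    sumTo n f   ≈⟨ sumTo-extend n k≤n (λ i 0<i i≤n → f≈0 i i≤n (ℕ.>⇒≢ 0<i)) ⟨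
    f 0         ∎
  sumTo-single n (suc k) {f} k≤n f≈0 = begin
    sumTo n f                ≈⟨ sumTo-extend n k≤n (λ i k<i i≤n → f≈0 i i≤n (ℕ.>⇒≢ k<i)) ⟨
    sumTo k f + f (suc k)
      ≈⟨ +-congʳ (sumTo-zero k (λ i i≤k → f≈0 i (ℕ.≤-trans i≤k (ℕ.<⇒≤ k≤n)) (ℕ.<⇒≢ (s≤s i≤k)))) ⟩
    0# + f (suc k)           ≈⟨ +-identityˡ _ ⟩
    f (suc k)                ∎

  sumTo-swap : ∀ a b (f : ℕ → ℕ → Carrier) →
               sumTo a (λ i → sumTo b (λ j → f i j)) ≈ sumTo b (λ j → sumTo a (λ i → f i j))
  sumTo-swap zero    b f = refl
  sumTo-swap (suc a) b f = trans (+-congʳ (sumTo-swap a b f))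
    (sym (sumTo-+ b (λ j → sumTo a (λ i → f i j)) (λ j → f (suc a) j)))

  sumTo-pascal : ∀ n (X Y : ℕ → Carrier) →
    sumTo (suc n) (λ i → fromℕ (suc n C i) * X i * Y (suc n ∸ i)) ≈
    sumTo n (λ i → fromℕ (n C i) * X (suc i) * Y (n ∸ i)) + sumTo n (λ i → fromℕ (n C i) * X i * Y (suc n ∸ i))
  sumTo-pascal n X Y = begin
    sumTo (suc n) R                                  ≈⟨ sumTo-suc n R ⟩
    B 0 + sumTo n (λ i → R (suc i))                  ≈⟨ +-congˡ (sumTo-cong n (λ i _ → pascal i)) ⟩
    B 0 + sumTo n (λ i → A i + B (suc i))            ≈⟨ +-congˡ (sumTo-+ n A (λ i → B (suc i))) ⟩
    B 0 + (sumTo n A + sumTo n (λ i → B (suc i)))    ≈⟨ solve 3 (λ b a b' → b :+ (a :+ b') := a :+ (b :+ b')) refl _ _ _ ⟩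
    sumTo n A + (B 0 + sumTo n (λ i → B (suc i)))    ≈⟨ +-congˡ (sumTo-suc n B) ⟨
    sumTo n A + sumTo (suc n) B                      ≈⟨ +-congˡ (sumTo-extend (suc n) (ℕ.n≤1+n n) B-vanishes) ⟨
    sumTo n A + sumTo n B                            ∎
    where
    A B R : ℕ → Carrier
    A i = fromℕ (n C i) * X (suc i) * Y (n ∸ i)
    B i = fromℕ (n C i) * X i * Y (suc n ∸ i)
    R i = fromℕ (suc n C i) * X i * Y (suc n ∸ i)

    pascal : ∀ i → R (suc i) ≈ A i + B (suc i)
    pascal i = begin
      fromℕ (suc n C suc i) * X (suc i) * Y (n ∸ i)
        ≡⟨ ≡.cong (λ c → fromℕ c * X (suc i) * Y (n ∸ i)) (nCk+nC[k+1]≡[n+1]C[k+1] n i) ⟨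
      fromℕ (n C i ℕ.+ n C suc i) * X (suc i) * Y (n ∸ i)
        ≈⟨ *-congʳ (*-congʳ (fromℕ-+ (n C i) (n C suc i))) ⟩
      (fromℕ (n C i) + fromℕ (n C suc i)) * X (suc i) * Y (n ∸ i)
        ≈⟨ solve 4 (λ a b u v → (a :+ b) :* u :* v := a :* u :* v :+ b :* u :* v) refl _ _ _ _ ⟩
      A i + B (suc i) ∎

    B-vanishes : ∀ i → n < i → i ≤ suc n → B i ≈ 0#
    B-vanishes i n<i _ = begin
      fromℕ (n C i) * X i * Y (suc n ∸ i)   ≡⟨ ≡.cong (λ c → fromℕ c * X i * Y (suc n ∸ i)) (k>n⇒nCk≡0 n<i) ⟩
      0# * X i * Y (suc n ∸ i)              ≈⟨ solve 2 (λ u v → con (+ 0) :* u :* v := con (+ 0)) refl _ _ ⟩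
      0#                                    ∎

  dfall-+ : ∀ μ n x y → dfall μ (x + y) n ≈ sumTo n (λ i → fromℕ (n C i) * dfall μ x i * dfall μ y (n ∸ i))
  dfall-+ μ zero    x y = solve 0 (con (+ 1) := (con (+ 1) :+ con (+ 0)) :* con (+ 1) :* con (+ 1)) refl
  dfall-+ μ (suc n) x y = begin
    dfall μ (x + y) n * (x + y - fromℕ n * μ)   ≈⟨ *-congʳ (dfall-+ μ n x y) ⟩
    sumTo n T * (x + y - fromℕ n * μ)           ≈⟨ sumTo-distribʳ n _ T ⟩
    sumTo n (λ i → T i * (x + y - fromℕ n * μ)) ≈⟨ sumTo-cong n split ⟩
    sumTo n (λ i → A i + B i)                   ≈⟨ sumTo-+ n A B ⟩
    sumTo n A + sumTo n B                       ≈⟨ sumTo-pascal n X Y ⟨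
    sumTo (suc n) (λ i → fromℕ (suc n C i) * X i * Y (suc n ∸ i)) ∎
    where
    X Y T A B : ℕ → Carrier
    X = dfall μ x
    Y = dfall μ y
    T i = fromℕ (n C i) * X i * Y (n ∸ i)
    A i = fromℕ (n C i) * X (suc i) * Y (n ∸ i)
    B i = fromℕ (n C i) * X i * Y (suc n ∸ i)

    split : ∀ i → i ≤ n → T i * (x + y - fromℕ n * μ) ≈ A i + B i
    split i i≤n = begin
      T i * (x + y - fromℕ n * μ)
        ≡⟨ ≡.cong (λ k → T i * (x + y - fromℕ k * μ)) (ℕ.m+[n∸m]≡n i≤n) ⟨
      T i * (x + y - fromℕ (i ℕ.+ (n ∸ i)) * μ)
        ≈⟨ *-congˡ (+-congˡ (-‿cong (*-congʳ (fromℕ-+ i (n ∸ i))))) ⟩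
      fromℕ (n C i) * X i * Y (n ∸ i) * (x + y - (fromℕ i + fromℕ (n ∸ i)) * μ)
        ≈⟨ solve 8 (λ c X Y x y a b m → c :* X :* Y :* ((x :+ y) :- (a :+ b) :* m)
                      := c :* (X :* (x :- a :* m)) :* Y :+ c :* X :* (Y :* (y :- b :* m))) refl _ _ _ _ _ _ _ _ ⟩
      A i + fromℕ (n C i) * X i * Y (suc (n ∸ i))
        ≡⟨ ≡.cong (λ k → A i + fromℕ (n C i) * X i * Y k) (ℕ.+-∸-assoc 1 i≤n) ⟨
      A i + B i ∎

  fall-suc-shift : ∀ x k → fall (1# + x) (suc k) ≈ fall x (suc k) + fromℕ (suc k) * fall x k
  fall-suc-shift x zero = solve 1 (λ x → con (+ 1) :* ((con (+ 1) :+ x) :- con (+ 0) :* con (+ 1))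
                          := con (+ 1) :* (x :- con (+ 0) :* con (+ 1)) :+ (con (+ 1) :+ con (+ 0)) :* con (+ 1)) refl x
  fall-suc-shift x (suc k) = begin
    fall (1# + x) (suc k) * (1# + x - fromℕ (suc k) * 1#)
      ≈⟨ *-congʳ (fall-suc-shift x k) ⟩
    (fall x (suc k) + fromℕ (suc k) * fall x k) * (1# + x - fromℕ (suc k) * 1#)
      ≈⟨ solve 3 (λ F x a →
             (F :* (x :- a :* con (+ 1)) :+ (con (+ 1) :+ a) :* F) :* ((con (+ 1) :+ x) :- (con (+ 1) :+ a) :* con (+ 1))
           := F :* (x :- a :* con (+ 1)) :* (x :- (con (+ 1) :+ a) :* con (+ 1))
              :+ (con (+ 1) :+ (con (+ 1) :+ a)) :* (F :* (x :- a :* con (+ 1))))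
                refl (fall x k) x (fromℕ k) ⟩
    fall x (suc (suc k)) + fromℕ (suc (suc k)) * fall x (suc k) ∎

  dfall-0 : ∀ μ k → dfall μ 0# (suc k) ≈ 0#
  dfall-0 μ zero    = solve 1 (λ m → con (+ 1) :* (con (+ 0) :- con (+ 0) :* m) := con (+ 0)) refl μ
  dfall-0 μ (suc k) = trans (*-congʳ (dfall-0 μ k)) (zeroˡ _)

  fall-fromℕ-vanishes : ∀ N k → N < k → fall (fromℕ N) k ≈ 0#
  fall-fromℕ-vanishes N (suc k) (s≤s N≤k) with ℕ.m≤n⇒m<n∨m≡n N≤k
  ... | inj₂ ≡.refl = solve 2 (λ f a → f :* (a :- a :* con (+ 1)) := con (+ 0)) refl (fall (fromℕ N) N) (fromℕ N)
  ... | inj₁ N<k    = trans (*-congʳ (fall-fromℕ-vanishes N k N<k)) (zeroˡ _)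

  fall-fromℕ*fact : ∀ N k → k ≤ N → fall (fromℕ N) k * fact (N ∸ k) ≈ fact N
  fall-fromℕ*fact N zero    _   = *-identityˡ _
  fall-fromℕ*fact N (suc k) k<N = begin
    fall (fromℕ N) k * (fromℕ N - fromℕ k * 1#) * fact (N ∸ suc k)
      ≡⟨ ≡.cong (λ m → fall (fromℕ N) k * (fromℕ m - fromℕ k * 1#) * fact (N ∸ suc k))
                (ℕ.m+[n∸m]≡n (ℕ.<⇒≤ k<N)) ⟨
    fall (fromℕ N) k * (fromℕ (k ℕ.+ (N ∸ k)) - fromℕ k * 1#) * fact (N ∸ suc k)
      ≈⟨ *-congʳ (*-congˡ (+-congʳ (fromℕ-+ k (N ∸ k)))) ⟩
    fall (fromℕ N) k * (fromℕ k + fromℕ (N ∸ k) - fromℕ k * 1#) * fact (N ∸ suc k)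
      ≈⟨ solve 4 (λ f a d g → f :* ((a :+ d) :- a :* con (+ 1)) :* g := f :* (d :* g)) refl _ _ _ _ ⟩
    fall (fromℕ N) k * (fromℕ (N ∸ k) * fact (N ∸ suc k))
      ≡⟨ ≡.cong (λ m → fall (fromℕ N) k * (fromℕ m * fact (N ∸ suc k))) (ℕ.+-∸-assoc 1 k<N) ⟩
    fall (fromℕ N) k * fact (suc (N ∸ suc k))
      ≡⟨ ≡.cong (λ m → fall (fromℕ N) k * fact m) (ℕ.+-∸-assoc 1 k<N) ⟨
    fall (fromℕ N) k * fact (N ∸ k)
      ≈⟨ fall-fromℕ*fact N k (ℕ.<⇒≤ k<N) ⟩
    fact N ∎

  fall-fromℕ-diag : ∀ N → fall (fromℕ N) N ≈ fact N
  fall-fromℕ-diag N = begin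
    fall (fromℕ N) N               ≈⟨ *-identityʳ _ ⟨
    fall (fromℕ N) N * fact 0      ≡⟨ ≡.cong (λ m → fall (fromℕ N) N * fact m) (ℕ.n∸n≡0 N) ⟨
    fall (fromℕ N) N * fact (N ∸ N) ≈⟨ fall-fromℕ*fact N N ℕ.≤-refl ⟩
    fact N ∎

  fall-coefficients-unique : ∀ n (a b : ℕ → Carrier) →
    (∀ N → sumTo n (λ k → a k * fall (fromℕ N) k) ≈ sumTo n (λ k → b k * fall (fromℕ N) k)) →
    ∀ k → k ≤ n → a k ≈ b k
  fall-coefficients-unique n a b agree k k≤n = x∙y⁻¹≈ε⇒x≈y (a k) (b k) (<-rec P difference≈0 k k≤n)
    where
    d : ℕ → Carrier
    d k = a k - b k

    P : ℕ → Set ℓ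
    P k = k ≤ n → d k ≈ 0#

    difference-sum : ∀ N → sumTo n (λ k → d k * fall (fromℕ N) k) ≈ 0#
    difference-sum N = begin
      sumTo n (λ k → d k * fall (fromℕ N) k)
        ≈⟨ sumTo-cong n (λ k _ → solve 3 (λ a b f → (a :- b) :* f := a :* f :- b :* f) refl (a k) (b k) _) ⟩
      sumTo n (λ k → a k * fall (fromℕ N) k - b k * fall (fromℕ N) k)
        ≈⟨ sumTo-minus n _ _ ⟩
      sumTo n (λ k → a k * fall (fromℕ N) k) - sumTo n (λ k → b k * fall (fromℕ N) k)
        ≈⟨ +-congʳ (agree N) ⟩
      sumTo n (λ k → b k * fall (fromℕ N) k) - sumTo n (λ k → b k * fall (fromℕ N) k)
        ≈⟨ -‿inverseʳ _ ⟩
      0# ∎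

    -- Evaluating at N = k isolates the coefficient d k: lower coefficients vanish by
    -- induction, and the higher falling factorials vanish at k.
    difference≈0 : ∀ k → (∀ {j} → j < k → P j) → P k
    difference≈0 k below k≤n = b*a≈0⇒b≈0 (fact≉0 k) (begin
      d k * fact k                              ≈⟨ *-congˡ (fall-fromℕ-diag k) ⟨
      d k * fall (fromℕ k) k                    ≈⟨ sumTo-single n k k≤n off-diagonal ⟨
      sumTo n (λ j → d j * fall (fromℕ k) j)    ≈⟨ difference-sum k ⟩
      0#                                        ∎)
      where
      off-diagonal : ∀ j → j ≤ n → j ≢ k → d j * fall (fromℕ k) j ≈ 0#
      off-diagonal j j≤n j≢k with ℕ.<-cmp j k
      ... | tri< j<k _ _ = trans (*-congʳ (below j<k j≤n)) (zeroˡ _)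
      ... | tri≈ _ j≡k _ = ⊥-elim (j≢k j≡k)
      ... | tri> _ _ k<j = trans (*-congˡ (fall-fromℕ-vanishes k j k<j)) (zeroʳ _)

  fact*·ₛ : ∀ (f g : Series) n →
    fact n * (f ·ₛ g) n ≈ sumTo n (λ i → fromℕ (n C i) * (fact i * f i) * (fact (n ∸ i) * g (n ∸ i)))
  fact*·ₛ f g n = trans (sumTo-distribˡ n (fact n) _) (sumTo-cong n term)
    where
    term : ∀ i → i ≤ n → fact n * (f i * g (n ∸ i)) ≈ fromℕ (n C i) * (fact i * f i) * (fact (n ∸ i) * g (n ∸ i))
    term i i≤n = begin
      fact n * (f i * g (n ∸ i))
        ≈⟨ *-congʳ (fact≈C*fact*fact i≤n) ⟩
      fromℕ (n C i) * fact i * fact (n ∸ i) * (f i * g (n ∸ i))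
        ≈⟨ solve 5 (λ c a b u v → c :* a :* b :* (u :* v) := c :* (a :* u) :* (b :* v)) refl _ _ _ _ _ ⟩
      fromℕ (n C i) * (fact i * f i) * (fact (n ∸ i) * g (n ∸ i)) ∎

  sumTo-fall-shift : ∀ n (f : ℕ → Carrier) → f (suc n) ≈ 0# → ∀ x →
    sumTo n (λ k → f k * fall (1# + x) k) ≈ sumTo n (λ k → (f k + fromℕ (suc k) * f (suc k)) * fall x k)
  sumTo-fall-shift n f f[n+1]≈0 x = begin
    sumTo n (λ k → f k * fall (1# + x) k)
      ≈⟨ sumTo-cong n (λ k _ → trans (*-congˡ (fall-shift k)) (distribˡ _ _ _)) ⟩
    sumTo n (λ k → f k * fall x k + f k * δ k)
      ≈⟨ sumTo-+ n _ _ ⟩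
    sumTo n (λ k → f k * fall x k) + sumTo n (λ k → f k * δ k)
      ≈⟨ +-congˡ (sumTo-extend (suc n) (ℕ.n≤1+n n) last-term-vanishes) ⟩
    sumTo n (λ k → f k * fall x k) + sumTo (suc n) (λ k → f k * δ k)
      ≈⟨ +-congˡ (sumTo-suc n _) ⟩
    sumTo n (λ k → f k * fall x k) + (f 0 * 0# + sumTo n (λ k → f (suc k) * (fromℕ (suc k) * fall x k)))
      ≈⟨ +-congˡ (trans (+-congʳ (zeroʳ _)) (+-identityˡ _)) ⟩
    sumTo n (λ k → f k * fall x k) + sumTo n (λ k → f (suc k) * (fromℕ (suc k) * fall x k))
      ≈⟨ sumTo-+ n _ _ ⟨
    sumTo n (λ k → f k * fall x k + f (suc k) * (fromℕ (suc k) * fall x k))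
      ≈⟨ sumTo-cong n (λ k _ → solve 4 (λ a b c F → a :* F :+ b :* (c :* F) := (a :+ c :* b) :* F) refl _ _ _ _) ⟩
    sumTo n (λ k → (f k + fromℕ (suc k) * f (suc k)) * fall x k) ∎
    where
    δ : ℕ → Carrier
    δ zero    = 0#
    δ (suc k) = fromℕ (suc k) * fall x k

    fall-shift : ∀ k → fall (1# + x) k ≈ fall x k + δ k
    fall-shift zero    = sym (+-identityʳ _)
    fall-shift (suc k) = fall-suc-shift x k

    last-term-vanishes : ∀ i → n < i → i ≤ suc n → f i * δ i ≈ 0#
    last-term-vanishes i n<i i≤1+n with ℕ.≤-antisym i≤1+n n<i
    ... | ≡.refl = trans (*-congʳ f[n+1]≈0) (zeroˡ _)

  sgn*dfall-neg : ∀ μ x l → sgn l * dfall μ (- x) l ≈ dfall (- μ) x l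
  sgn*dfall-neg μ x zero    = *-identityˡ _
  sgn*dfall-neg μ x (suc l) = begin
    (- 1# * sgn l) * (dfall μ (- x) l * (- x - fromℕ l * μ))
      ≈⟨ solve 5 (λ s D x a m → ((:- con (+ 1)) :* s) :* (D :* ((:- x) :- a :* m)) := (s :* D) :* (x :- a :* (:- m)))
               refl _ _ _ _ _ ⟩
    (sgn l * dfall μ (- x) l) * (x - fromℕ l * - μ)
      ≈⟨ *-congʳ (sgn*dfall-neg μ x l) ⟩
    dfall (- μ) x l * (x - fromℕ l * - μ) ∎

  fact*negArg-eS : ∀ μ x l → fact l * negArg (eS μ (- x)) l ≈ dfall (- μ) x l
  fact*negArg-eS μ x l = begin
    fact l * (sgn l * (dfall μ (- x) l * fact l ⁻¹))
      ≈⟨ solve 4 (λ f s d f' → f :* (s :* (d :* f')) := s :* d :* (f :* f')) refl _ _ _ _ ⟩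
    sgn l * dfall μ (- x) l * (fact l * fact l ⁻¹)
      ≈⟨ *-congˡ (fact*fact⁻¹≈1 l) ⟩
    sgn l * dfall μ (- x) l * 1#
      ≈⟨ *-identityʳ _ ⟩
    sgn l * dfall μ (- x) l
      ≈⟨ sgn*dfall-neg μ x l ⟩
    dfall (- μ) x l ∎

  module DegenerateStirling (lam : Carrier) (S : ℕ → ℕ → Carrier) (isS : IsDegStirling2 lam S) where

    S-vanishes : ∀ n k → n < k → S n k ≈ 0#
    S-vanishes = proj₁ isS

    dfall-expand : ∀ n x → dfall lam x n ≈ sumTo n (λ k → S n k * fall x k)
    dfall-expand = proj₂ isS

    dfall-expand-≤ : ∀ {m} n x → m ≤ n → dfall lam x m ≈ sumTo n (λ k → S m k * fall x k)
    dfall-expand-≤ {m} n x m≤n = trans (dfall-expand m x)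
      (sumTo-extend n m≤n (λ k m<k _ → trans (*-congʳ (S-vanishes m k m<k)) (zeroˡ _)))

    S-n-0 : ∀ n → S n 0 ≈ dfall lam 0# n
    S-n-0 n = sym (begin
      dfall lam 0# n                    ≈⟨ dfall-expand n 0# ⟩
      sumTo n (λ k → S n k * fall 0# k) ≈⟨ sumTo-single n 0 z≤n higher ⟩
      S n 0 * 1#                        ≈⟨ *-identityʳ _ ⟩
      S n 0                             ∎)
      where
      higher : ∀ k → k ≤ n → k ≢ 0 → S n k * fall 0# k ≈ 0#
      higher zero    _ 0≢0 = ⊥-elim (0≢0 ≡.refl)
      higher (suc k) _ _   = trans (*-congˡ (dfall-0 1# k)) (zeroʳ _)

    binomialS : ℕ → ℕ → Carrier
    binomialS n k = sumTo n (λ i → fromℕ (n C i) * dfall lam 1# i * S (n ∸ i) k)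

    dfall-1+x-binomialS : ∀ n x → dfall lam (1# + x) n ≈ sumTo n (λ k → binomialS n k * fall x k)
    dfall-1+x-binomialS n x = begin
      dfall lam (1# + x) n
        ≈⟨ dfall-+ lam n 1# x ⟩
      sumTo n (λ i → w i * dfall lam x (n ∸ i))
        ≈⟨ sumTo-cong n (λ i _ → *-congˡ (dfall-expand-≤ n x (ℕ.m∸n≤m n i))) ⟩
      sumTo n (λ i → w i * sumTo n (λ k → S (n ∸ i) k * fall x k))
        ≈⟨ sumTo-cong n (λ i _ → trans (sumTo-distribˡ n (w i) _) (sumTo-cong n (λ k _ → sym (*-assoc _ _ _)))) ⟩
      sumTo n (λ i → sumTo n (λ k → w i * S (n ∸ i) k * fall x k))
        ≈⟨ sumTo-swap n n _ ⟩
      sumTo n (λ k → sumTo n (λ i → w i * S (n ∸ i) k * fall x k))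
        ≈⟨ sumTo-cong n (λ k _ → sym (sumTo-distribʳ n (fall x k) _)) ⟩
      sumTo n (λ k → binomialS n k * fall x k) ∎
      where
      w : ℕ → Carrier
      w i = fromℕ (n C i) * dfall lam 1# i

    dfall-1+x-shifted : ∀ n x →
      dfall lam (1# + x) n ≈ sumTo n (λ k → (S n k + fromℕ (suc k) * S n (suc k)) * fall x k)
    dfall-1+x-shifted n x = trans (dfall-expand n (1# + x))
      (sumTo-fall-shift n (S n) (S-vanishes n (suc n) (ℕ.n<1+n n)) x)

    S-binomial-recurrence : ∀ n k → binomialS n k ≈ S n k + fromℕ (suc k) * S n (suc k)
    S-binomial-recurrence n k with k ℕ.≤? n
    ... | yes k≤n = fall-coefficients-unique n (binomialS n) (λ k → S n k + fromℕ (suc k) * S n (suc k))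
      (λ N → trans (sym (dfall-1+x-binomialS n (fromℕ N))) (dfall-1+x-shifted n (fromℕ N))) k k≤n
    ... | no k≰n = begin
      binomialS n k
        ≈⟨ sumTo-zero n (λ i _ → trans (*-congˡ (S-vanishes (n ∸ i) k (ℕ.≤-<-trans (ℕ.m∸n≤m n i) n<k))) (zeroʳ _)) ⟩
      0#
        ≈⟨ solve 1 (λ c → con (+ 0) := con (+ 0) :+ c :* con (+ 0)) refl _ ⟩
      0# + fromℕ (suc k) * 0#
        ≈⟨ +-cong (S-vanishes n k n<k) (*-congˡ (S-vanishes n (suc k) (ℕ.m<n⇒m<1+n n<k))) ⟨
      S n k + fromℕ (suc k) * S n (suc k) ∎
      where
      n<k : n < k
      n<k = ℕ.≰⇒> k≰n

    1-e[-t] : Series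
    1-e[-t] = oneS -ₛ negArg (eS lam 1#)

    fact*1-e[-t] : ∀ i → fact i * 1-e[-t] i ≈ oneS i - sgn i * dfall lam 1# i
    fact*1-e[-t] i = begin
      fact i * (oneS i - sgn i * (dfall lam 1# i * fact i ⁻¹))
        ≈⟨ solve 5 (λ f o s d f' → f :* (o :- s :* (d :* f')) := f :* o :- s :* d :* (f :* f')) refl _ _ _ _ _ ⟩
      fact i * oneS i - sgn i * dfall lam 1# i * (fact i * fact i ⁻¹)
        ≈⟨ +-cong (fact*oneS i) (-‿cong (*-congˡ (fact*fact⁻¹≈1 i))) ⟩
      oneS i - sgn i * dfall lam 1# i * 1#
        ≈⟨ +-congˡ (-‿cong (*-identityʳ _)) ⟩
      oneS i - sgn i * dfall lam 1# i ∎
      where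
      fact*oneS : ∀ i → fact i * oneS i ≈ oneS i
      fact*oneS zero    = *-identityˡ _
      fact*oneS (suc i) = zeroʳ _

    -- The generating function (e_λ(t) - 1)^m / m! = Σ_n S(n,m) tⁿ / n!, read at -t.
    fact*powS-1-e[-t] : ∀ m n → fact n * powS 1-e[-t] m n ≈ sgn m * sgn n * fact m * S n m
    fact*powS-1-e[-t] zero zero    = trans
      (solve 0 (con (+ 1) :* con (+ 1) := con (+ 1) :* con (+ 1) :* con (+ 1) :* con (+ 1)) refl)
      (*-congˡ (sym (S-n-0 0)))
    fact*powS-1-e[-t] zero (suc n) = begin
      fact (suc n) * 0#                              ≈⟨ zeroʳ _ ⟩
      0#                                             ≈⟨ zeroʳ _ ⟨
      1# * sgn (suc n) * 1# * 0#                     ≈⟨ *-congˡ (trans (S-n-0 (suc n)) (dfall-0 lam n)) ⟨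
      1# * sgn (suc n) * 1# * S (suc n) 0            ∎
    fact*powS-1-e[-t] (suc m) n = begin
      fact n * (1-e[-t] ·ₛ powS 1-e[-t] m) n
        ≈⟨ fact*·ₛ 1-e[-t] (powS 1-e[-t] m) n ⟩
      sumTo n (λ i → fromℕ (n C i) * (fact i * 1-e[-t] i) * (fact (n ∸ i) * powS 1-e[-t] m (n ∸ i)))
        ≈⟨ sumTo-cong n (λ i i≤n → *-cong (*-congˡ (fact*1-e[-t] i)) (fact*powS-1-e[-t] m (n ∸ i))) ⟩
      sumTo n (λ i → fromℕ (n C i) * (oneS i - sgn i * dfall lam 1# i) * Z (n ∸ i))
        ≈⟨ sumTo-cong n split ⟩
      sumTo n (λ i → U i - sgn m * sgn n * fact m * (fromℕ (n C i) * dfall lam 1# i * S (n ∸ i) m))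
        ≈⟨ sumTo-minus n _ _ ⟩
      sumTo n U - sumTo n (λ i → sgn m * sgn n * fact m * (fromℕ (n C i) * dfall lam 1# i * S (n ∸ i) m))
        ≈⟨ +-cong (sumTo-single n 0 z≤n U-vanishes) (-‿cong (sym (sumTo-distribˡ n _ _))) ⟩
      U 0 - sgn m * sgn n * fact m * binomialS n m
        ≈⟨ +-congˡ (-‿cong (*-congˡ (S-binomial-recurrence n m))) ⟩
      U 0 - sgn m * sgn n * fact m * (S n m + fromℕ (suc m) * S n (suc m))
        ≈⟨ solve 6 (λ a b f S S' k → (con (+ 1) :+ con (+ 0)) :* con (+ 1) :* (a :* b :* f :* S)
                                    :- a :* b :* f :* (S :+ (con (+ 1) :+ k) :* S')
                                 := ((:- con (+ 1)) :* a) :* b :* ((con (+ 1) :+ k) :* f) :* S')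
                 refl (sgn m) (sgn n) (fact m) (S n m) (S n (suc m)) (fromℕ m) ⟩
      sgn (suc m) * sgn n * fact (suc m) * S n (suc m) ∎
      where
      Z U : ℕ → Carrier
      Z l = sgn m * sgn l * fact m * S l m
      U i = fromℕ (n C i) * oneS i * Z (n ∸ i)

      split : ∀ i → i ≤ n → fromℕ (n C i) * (oneS i - sgn i * dfall lam 1# i) * Z (n ∸ i) ≈
                            U i - sgn m * sgn n * fact m * (fromℕ (n C i) * dfall lam 1# i * S (n ∸ i) m)
      split i i≤n = begin
        fromℕ (n C i) * (oneS i - sgn i * dfall lam 1# i) * Z (n ∸ i)
          ≈⟨ solve 8 (λ c o s d a t f S → c :* (o :- s :* d) :* (a :* t :* f :* S)
                                       := c :* o :* (a :* t :* f :* S) :- a :* (s :* t) :* f :* (c :* d :* S))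
                   refl _ _ _ _ _ _ _ _ ⟩
        U i - sgn m * (sgn i * sgn (n ∸ i)) * fact m * (fromℕ (n C i) * dfall lam 1# i * S (n ∸ i) m)
          ≈⟨ +-congˡ (-‿cong (*-congʳ (*-congʳ (*-congˡ (sgn*sgn-∸ i≤n))))) ⟩
        U i - sgn m * sgn n * fact m * (fromℕ (n C i) * dfall lam 1# i * S (n ∸ i) m) ∎

      U-vanishes : ∀ i → i ≤ n → i ≢ 0 → U i ≈ 0#
      U-vanishes zero    _ 0≢0 = ⊥-elim (0≢0 ≡.refl)
      U-vanishes (suc i) _ _   = trans (*-congʳ (zeroʳ _)) (zeroˡ _)

    liCoeff : ℤ → ℕ → Carrier
    liCoeff p k = (lam ^ k) * dfall (lam ⁻¹) 1# (suc k) * invPow (fromℕ (suc k)) p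

    LiOverY*fact*powS : ∀ p m i → LiOverY p lam m * (fact i * powS 1-e[-t] m i) ≈ liCoeff p m * (sgn i * S i m)
    LiOverY*fact*powS p m i = begin
      (- lam) ^ m * D * fact m ⁻¹ * P * (fact i * powS 1-e[-t] m i)
        ≈⟨ *-cong (*-congʳ (*-congʳ (*-congʳ (-^≈sgn*^ lam m)))) (fact*powS-1-e[-t] m i) ⟩
      sgn m * lam ^ m * D * fact m ⁻¹ * P * (sgn m * sgn i * fact m * S i m)
        ≈⟨ solve 8 (λ s L D f' P t f S → s :* L :* D :* f' :* P :* (s :* t :* f :* S)
                                     := (s :* s) :* (f :* f') :* (L :* D :* P) :* (t :* S))
                 refl _ _ _ _ _ _ _ _ ⟩
      (sgn m * sgn m) * (fact m * fact m ⁻¹) * liCoeff p m * (sgn i * S i m)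
        ≈⟨ *-congʳ (*-congʳ (*-cong (sgn*sgn≈1 m) (fact*fact⁻¹≈1 m))) ⟩
      1# * 1# * liCoeff p m * (sgn i * S i m)
        ≈⟨ solve 2 (λ c w → con (+ 1) :* con (+ 1) :* c :* w := c :* w) refl _ _ ⟩
      liCoeff p m * (sgn i * S i m) ∎
      where
      D P : Carrier
      D = dfall (lam ⁻¹) 1# (suc m)
      P = invPow (fromℕ (suc m)) p

    fact*compS : ∀ p {i n} → i ≤ n →
      fact i * compS (LiOverY p lam) 1-e[-t] i ≈ sumTo n (λ m → liCoeff p m * (sgn i * S i m))
    fact*compS p {i} {n} i≤n = begin
      fact i * sumTo i (λ m → LiOverY p lam m * powS 1-e[-t] m i)
        ≈⟨ sumTo-distribˡ i (fact i) _ ⟩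
      sumTo i (λ m → fact i * (LiOverY p lam m * powS 1-e[-t] m i))
        ≈⟨ sumTo-cong i (λ m _ → trans (x∙yz≈y∙xz _ _ _) (LiOverY*fact*powS p m i)) ⟩
      sumTo i (λ m → liCoeff p m * (sgn i * S i m))
        ≈⟨ sumTo-extend n i≤n (λ m i<m _ → trans (*-congˡ (*-congˡ (S-vanishes i m i<m)))
                                                  (trans (*-congˡ (zeroʳ _)) (zeroʳ _))) ⟩
      sumTo n (λ m → liCoeff p m * (sgn i * S i m)) ∎

theorem9 : ∀ {c ℓ : Level} (F : CharZeroField c ℓ) →
    let open FieldDefs F in
    (lam : Carrier) → ¬ (lam ≈ 0#) →
    (S : ℕ → ℕ → Carrier) → IsDegStirling2 lam S →
    (n : ℕ) (p : ℤ) (x : Carrier) →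
    beta p lam n x ≈
      sumTo n (λ k →
        (lam ^ k) * dfall (lam ⁻¹) 1# (suc k) * invPow (fromℕ (suc k)) p *
        sumTo n (λ j →
          fromℕ (n C j) * ((- 1#) ^ j) * S j k * dfall (- lam) x (n ∸ j)))
theorem9 F lam _ S isS n p x = begin
  fact n * (A ·ₛ B) n
    ≈⟨ fact*·ₛ A B n ⟩
  sumTo n (λ j → fromℕ (n C j) * (fact j * A j) * (fact (n ∸ j) * B (n ∸ j)))
    ≈⟨ sumTo-cong n (λ j j≤n → *-cong (*-congˡ (fact*compS p j≤n)) (fact*negArg-eS lam x (n ∸ j))) ⟩
  sumTo n (λ j → fromℕ (n C j) * sumTo n (λ k → liCoeff p k * (sgn j * S j k)) * E j)
    ≈⟨ sumTo-cong n (λ j _ → trans (*-congʳ (sumTo-distribˡ n _ _)) (sumTo-distribʳ n _ _)) ⟩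
  sumTo n (λ j → sumTo n (λ k → fromℕ (n C j) * (liCoeff p k * (sgn j * S j k)) * E j))
    ≈⟨ sumTo-cong n (λ j _ → sumTo-cong n (λ k _ →
         solve 5 (λ b c s t e → b :* (c :* (s :* t)) :* e := c :* (b :* s :* t :* e)) refl _ _ _ _ _)) ⟩
  sumTo n (λ j → sumTo n (λ k → liCoeff p k * (fromℕ (n C j) * sgn j * S j k * E j)))
    ≈⟨ sumTo-swap n n _ ⟩
  sumTo n (λ k → sumTo n (λ j → liCoeff p k * (fromℕ (n C j) * sgn j * S j k * E j)))
    ≈⟨ sumTo-cong n (λ k _ → sym (sumTo-distribˡ n _ _)) ⟩
  sumTo n (λ k → liCoeff p k * sumTo n (λ j → fromℕ (n C j) * sgn j * S j k * E j)) ∎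
  where
  open FieldDefs F
  open Development F
  open DegenerateStirling lam S isS
  open IntegerEmbedding commRing using (solve; _:=_; _:*_)
  open import Relation.Binary.Reasoning.Setoid setoid

  A B : Series
  A = compS (LiOverY p lam) 1-e[-t]
  B = negArg (eS lam (- x))

  E : ℕ → Carrier
  E j = dfall (- lam) x (n ∸ j)
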